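{- (1) $\Phi(1)=6$, and $6\le\Phi(n)<6n\sqrt[3]{n}$ for every integer $n>1$. (2) For an integer $n>0$, put $t=v_2(n)+2$ and let $p_1=2<p_2<\dots<p_t$ be the first $t$ prime numbers. Then $\Phi(n)\le 2n\prod_{i=1}^t\frac{p_i}{p_i-1}$. In particular, $\Phi(n)\le 6n$ if $n$ is odd. (3) If $n>3$ is an odd prime, then $\Phi(n)=6$ if $2n+1$ is not prime, and $\Phi(n)=4n+2$ if $2n+1$ is prime.
   Context: For an integer $n>0$, $\Phi(n)=\max\{m\in\mathbb{Z} : \varphi(m)\text{ divides }2n\}$, where $\varphi$ is Euler's totient function. $v_2$ is the $2$-adic valuation. -}

module Defs where

open import Data.Nat using (ℕ; zero; suc; _+_; _*_; _∸_; _^_; _≤_; _<_)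
open import Data.Nat.Divisibility using (_∣_)
open import Data.Nat.Coprimality using (coprime?)
open import Data.Nat.Primality using (Prime)
open import Data.List using (List; length; filter; map; upTo)
open import Data.Fin using (Fin; zero; suc)
import Data.Fin as Fin
open import Data.Product using (_×_)
open import Relation.Nullary using (¬_)
open import Relation.Binary.PropositionalEquality using (_≢_)

φ : ℕ → ℕ
φ m = length (filter (λ k → coprime? k m) (map suc (upTo m)))

-- IsΦ n M : M is the maximum of { m ≥ 1 : φ(m) ∣ 2n }, i.e. Φ(n) = M.
-- (φ is only defined on positive integers, so m ranges over m ≥ 1.)
IsΦ : ℕ → ℕ → Set
IsΦ n M = 1 ≤ M × φ M ∣ 2 * n × (∀ m → 1 ≤ m → φ m ∣ 2 * n → m ≤ M)

IsV2 : ℕ → ℕ → Set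
IsV2 n k = 2 ^ k ∣ n × ¬ (2 ^ suc k ∣ n)

FirstPrimes : (t : ℕ) → (Fin t → ℕ) → Set
FirstPrimes t ps =
  (∀ i → Prime (ps i)) ×
  (∀ i j → i Fin.< j → ps i < ps j) ×
  (∀ q → Prime q → (∀ i → ps i ≢ q) → ∀ i → ps i < q)

prodF : (t : ℕ) → (Fin t → ℕ) → ℕ
prodF zero f = 1
prodF (suc t) f = f zero * prodF t (λ i → f (suc i))

-- Write m = 2^a · q₁^e₁ ⋯ q_r^e_r with odd primes q₁ < ⋯ < q_r. Every odd prime
-- factor contributes a factor q − 1, hence a factor 2, to φ(m); so if φ(m) ∣ 2n then
-- 2^(r+1) ∤ φ(m) and r ≤ v₂(n) + 1. Peeling off the prime powers from the smallest one
-- up gives m/φ(m) ≤ 2 ∏ f_i/(f_i − 1) for any f with f_i ≤ q_i, and f can be taken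
-- to be the first odd primes (part 2) or the odd numbers 3, 5, 7, … (part 1, where
-- (c/(c − 1))³ < 2 for c ≥ 5 bounds the cube of the product beyond 3/2 by 2^v₂(n) ≤ n).
-- In particular the solutions of φ(m) ∣ 2n are bounded, so Φ(n) exists. For a prime
-- n > 3, 4 ∤ 2n leaves only m ≤ 6 and, when 2n + 1 is prime, m ∈ {2n + 1, 4n + 2}.

module Submission where

open import Defs
open import Level using (0ℓ)
open import Data.Nat.Base
open import Data.Nat.Properties
open import Data.Nat.Divisibility
open import Data.Nat.Coprimality as Coprime using (Coprime; coprime?; coprime-divisor)
open import Data.Nat.Primality
open import Data.Nat.Induction using (<-rec)
open import Data.Nat.Solver using (module +-*-Solver)
open import Algebra.Properties.CommutativeSemigroup +-commutativeSemigroup using () renaming (interchange to +-interchange)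
open import Algebra.Properties.CommutativeSemigroup *-commutativeSemigroup using (x∙yz≈y∙xz)
open import Data.List.Base using ([]; _∷_; _++_; length; filter; map; upTo)
open import Data.List.Properties using (upTo-∷ʳ; map-++)
open import Data.Fin.Base using (Fin; zero; suc; toℕ; inject₁)
open import Data.Fin.Properties using (any?; toℕ-injective; toℕ-inject₁)
open import Data.Product.Base using (_×_; _,_; proj₁; proj₂; ∃; ∃₂)
open import Data.Sum.Base using (_⊎_; inj₁; inj₂; [_,_]′)
open import Data.Unit.Base using (⊤; tt)
open import Data.Empty using (⊥-elim)
open import Function.Base using (_∘_)
open import Function.Bundles using (_⇔_; mk⇔; Equivalence)
open import Relation.Nullary using (¬_; Dec; yes; no)
open import Relation.Nullary.Decidable using (_×-dec_; ¬?)
open import Relation.Unary using (Pred; Decidable)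
open import Relation.Binary.PropositionalEquality
open +-*-Solver using (solve; _:=_; _:+_; _:*_; _:^_; con)

prime⇒2≤ : ∀ {p} → Prime p → 2 ≤ p
prime⇒2≤ {p} p-prime = nonTrivial⇒n>1 p {{prime⇒nonTrivial p-prime}}

prime∤1 : ∀ {p} → Prime p → ¬ p ∣ 1
prime∤1 p-prime p∣1 = <⇒≱ (prime⇒2≤ p-prime) (∣⇒≤ p∣1)

2∣n⊎2∣1+n : ∀ n → 2 ∣ n ⊎ 2 ∣ suc n
2∣n⊎2∣1+n zero    = inj₁ (divides 0 refl)
2∣n⊎2∣1+n (suc n) with 2∣n⊎2∣1+n n
... | inj₁ 2∣n   = inj₂ (∣m∣n⇒∣m+n (divides 1 refl) 2∣n)
... | inj₂ 2∣1+n = inj₁ 2∣1+n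

prime∣odd⇒2<p : ∀ {p m} → Prime p → p ∣ m → ¬ 2 ∣ m → 2 < p
prime∣odd⇒2<p p-prime p∣m 2∤m with m≤n⇒m<n∨m≡n (prime⇒2≤ p-prime)
... | inj₁ 2<p  = 2<p
... | inj₂ refl = ⊥-elim (2∤m p∣m)

2∣odd-prime∸1 : ∀ {q} → Prime q → 2 < q → 2 ∣ q ∸ 1
2∣odd-prime∸1 {suc q} q-prime 2<q with 2∣n⊎2∣1+n q
... | inj₁ 2∣q   = 2∣q
... | inj₂ 2∣1+q with prime⇒irreducible q-prime 2∣1+q
...   | inj₁ ()
...   | inj₂ 2≡1+q = ⊥-elim (<⇒≢ 2<q 2≡1+q)

-- Counting

private variable
  P Q : Pred ℕ 0ℓ

indicator : ∀ {A : Set} → Dec A → ℕ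
indicator (yes _) = 1
indicator (no _)  = 0

count : Decidable P → ℕ → ℕ
count P? zero    = 0
count P? (suc n) = count P? n + indicator (P? (suc n))

indicator-cong : ∀ {A B : Set} → A ⇔ B → (A? : Dec A) (B? : Dec B) → indicator A? ≡ indicator B?
indicator-cong A⇔B (yes a) (yes b) = refl
indicator-cong A⇔B (yes a) (no ¬b) = ⊥-elim (¬b (Equivalence.to A⇔B a))
indicator-cong A⇔B (no ¬a) (yes b) = ⊥-elim (¬a (Equivalence.from A⇔B b))
indicator-cong A⇔B (no _)  (no _)  = refl

count-cong : (P? : Decidable P) (Q? : Decidable Q) → ∀ n →
             (∀ k → 1 ≤ k → k ≤ n → P k ⇔ Q k) → count P? n ≡ count Q? n
count-cong P? Q? zero    P⇔Q = refl
count-cong P? Q? (suc n) P⇔Q = cong₂ _+_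
  (count-cong P? Q? n (λ k 1≤k k≤n → P⇔Q k 1≤k (m≤n⇒m≤1+n k≤n)))
  (indicator-cong (P⇔Q (suc n) (s≤s z≤n) ≤-refl) (P? (suc n)) (Q? (suc n)))

count≡0 : (P? : Decidable P) → ∀ n → (∀ k → 1 ≤ k → k ≤ n → ¬ P k) → count P? n ≡ 0
count≡0 P? zero    ¬P = refl
count≡0 P? (suc n) ¬P with P? (suc n)
... | yes p = ⊥-elim (¬P (suc n) (s≤s z≤n) ≤-refl p)
... | no _  = trans (+-identityʳ _) (count≡0 P? n (λ k 1≤k k≤n → ¬P k 1≤k (m≤n⇒m≤1+n k≤n)))

count-+ : (P? : Decidable P) → ∀ a c → count P? (a + c) ≡ count P? a + count (P? ∘ (a +_)) c
count-+ P? a zero    = trans (cong (count P?) (+-identityʳ a)) (sym (+-identityʳ _))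
count-+ P? a (suc c) = begin
  count P? (a + suc c)                                            ≡⟨ cong (count P?) (+-suc a c) ⟩
  count P? (a + c) + indicator (P? (suc (a + c)))                 ≡⟨ cong₂ _+_ (count-+ P? a c) (cong (indicator ∘ P?) (sym (+-suc a c))) ⟩
  count P? a + count (P? ∘ (a +_)) c + indicator (P? (a + suc c)) ≡⟨ +-assoc (count P? a) _ _ ⟩
  count P? a + count (P? ∘ (a +_)) (suc c)                        ∎
  where open ≡-Reasoning

count-periodic : (P? : Decidable P) → ∀ m → (∀ k → P (m + k) ⇔ P k) →
                 ∀ c → count P? (c * m) ≡ c * count P? m
count-periodic P? m period zero    = refl
count-periodic P? m period (suc c) = begin
  count P? (m + c * m)                     ≡⟨ count-+ P? m (c * m) ⟩
  count P? m + count (P? ∘ (m +_)) (c * m) ≡⟨ cong (count P? m +_) (count-cong _ P? (c * m) (λ k _ _ → period k)) ⟩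
  count P? m + count P? (c * m)            ≡⟨ cong (count P? m +_) (count-periodic P? m period c) ⟩
  count P? m + c * count P? m              ∎
  where open ≡-Reasoning

count-split : (P? : Decidable P) (Q? : Decidable Q) → ∀ n →
  count (λ k → P? k ×-dec ¬? (Q? k)) n + count (λ k → P? k ×-dec Q? k) n ≡ count P? n
count-split P? Q? zero    = refl
count-split P? Q? (suc n) = trans
  (+-interchange (count (λ k → P? k ×-dec ¬? (Q? k)) n) (indicator (P? (suc n) ×-dec ¬? (Q? (suc n))))
                 (count (λ k → P? k ×-dec Q? k) n) (indicator (P? (suc n) ×-dec Q? (suc n))))
  (cong₂ _+_ (count-split P? Q? n) (split (P? (suc n)) (Q? (suc n))))
  where
  split : ∀ {A B : Set} (A? : Dec A) (B? : Dec B) →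
          indicator (A? ×-dec ¬? B?) + indicator (A? ×-dec B?) ≡ indicator A?
  split (yes _) (yes _) = refl
  split (yes _) (no _)  = refl
  split (no _)  (yes _) = refl
  split (no _)  (no _)  = refl

count-multiples : (P? : Decidable P) → ∀ p .{{_ : NonZero p}} m →
  count (λ k → P? k ×-dec (p ∣? k)) (m * p) ≡ count (P? ∘ (_* p)) m
count-multiples P? p zero = refl
count-multiples {P} P? p@(suc p′) (suc m) = begin
  count Q? (p + m * p)                                    ≡⟨ cong (count Q?) (+-comm p (m * p)) ⟩
  count Q? (m * p + p)                                    ≡⟨ count-+ Q? (m * p) p ⟩
  count Q? (m * p) + (count (Q? ∘ (m * p +_)) p′ + last?) ≡⟨ cong₂ (λ a b → a + (b + last?)) (count-multiples P? p m) (count≡0 _ p′ no-multiple) ⟩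
  count (P? ∘ (_* p)) m + last?                           ≡⟨ cong (count (P? ∘ (_* p)) m +_) (indicator-cong last⇔ (Q? _) (P? _)) ⟩
  count (P? ∘ (_* p)) m + indicator (P? (p + m * p))      ∎
  where
  open ≡-Reasoning
  Q? = λ k → P? k ×-dec (p ∣? k)
  last? = indicator (Q? (m * p + p))
  last⇔ : (P (m * p + p) × p ∣ m * p + p) ⇔ P (p + m * p)
  last⇔ = mk⇔ (λ (x , _) → subst P (+-comm (m * p) p) x)
              (λ x → subst P (+-comm p (m * p)) x , ∣m∣n⇒∣m+n (n∣m*n m) ∣-refl)
  no-multiple : ∀ k → 1 ≤ k → k ≤ p′ → ¬ (P (m * p + k) × p ∣ m * p + k)
  no-multiple k 1≤k k≤p′ (_ , p∣) =
    <⇒≱ (s≤s k≤p′) (∣⇒≤ {{>-nonZero 1≤k}} (∣m+n∣m⇒∣n p∣ (n∣m*n m)))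

length-filter≡count : (P? : Decidable P) → ∀ n → length (filter P? (map suc (upTo n))) ≡ count P? n
length-filter≡count P? zero    = refl
length-filter≡count P? (suc n) = begin
  length (filter P? (map suc (upTo (suc n))))                    ≡⟨ cong (length ∘ filter P? ∘ map suc) (sym (upTo-∷ʳ n)) ⟩
  length (filter P? (map suc (upTo n ++ n ∷ [])))                ≡⟨ cong (length ∘ filter P?) (map-++ suc (upTo n) (n ∷ [])) ⟩
  length (filter P? (map suc (upTo n) ++ suc n ∷ []))            ≡⟨ length-filter-∷ʳ (map suc (upTo n)) ⟩
  length (filter P? (map suc (upTo n))) + indicator (P? (suc n)) ≡⟨ cong (_+ indicator (P? (suc n))) (length-filter≡count P? n) ⟩
  count P? (suc n)                                               ∎
  where
  open ≡-Reasoning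
  length-filter-∷ʳ : ∀ {x} xs → length (filter P? (xs ++ x ∷ [])) ≡ length (filter P? xs) + indicator (P? x)
  length-filter-∷ʳ {x} [] with P? x
  ... | yes _ = refl
  ... | no _  = refl
  length-filter-∷ʳ (y ∷ xs) with P? y
  ... | yes _ = cong suc (length-filter-∷ʳ xs)
  ... | no _  = length-filter-∷ʳ xs

-- Euler's totient

φ≡count : ∀ m → φ m ≡ count (λ k → coprime? k m) m
φ≡count m = length-filter≡count (λ k → coprime? k m) m

coprime-+ˡ-⇔ : ∀ m k → Coprime (m + k) m ⇔ Coprime k m
coprime-+ˡ-⇔ m k = mk⇔ (λ c {_} (d∣k , d∣m) → c (∣m∣n⇒∣m+n d∣m d∣k , d∣m))
                       (λ c {_} (d∣m+k , d∣m) → c (∣m+n∣m⇒∣n d∣m+k d∣m , d∣m))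

coprime-*-⇔ : ∀ k a b → Coprime k (a * b) ⇔ (Coprime k a × Coprime k b)
coprime-*-⇔ k a b = mk⇔
  (λ c → (λ {_} (d∣k , d∣a) → c (d∣k , ∣m⇒∣m*n b d∣a)) , (λ {_} (d∣k , d∣b) → c (d∣k , ∣n⇒∣m*n a d∣b)))
  (λ (ca , cb) {d} (d∣k , d∣ab) →
    cb (d∣k , coprime-divisor (λ {_} (e∣d , e∣a) → ca (∣-trans e∣d d∣k , e∣a)) d∣ab))

coprime-prime-⇔ : ∀ {p} k → Prime p → Coprime k p ⇔ (¬ p ∣ k)
coprime-prime-⇔ {p} k p-prime = mk⇔
  (λ c p∣k → nonTrivial⇒≢1 {{prime⇒nonTrivial p-prime}} (c (p∣k , ∣-refl)))
  (λ p∤k {d} (d∣k , d∣p) →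
    [ (λ d≡1 → d≡1) , (λ d≡p → ⊥-elim (p∤k (subst (_∣ k) d≡p d∣k))) ]′ (prime⇒irreducible p-prime d∣p))

φ[d*m]≡d*φ[m] : ∀ {d} m → d ∣ m → φ (d * m) ≡ d * φ m
φ[d*m]≡d*φ[m] {d} m d∣m = begin
  φ (d * m)                                ≡⟨ φ≡count (d * m) ⟩
  count (λ k → coprime? k (d * m)) (d * m) ≡⟨ count-cong _ _ (d * m) (λ k _ _ → coprime-d*m⇔ k) ⟩
  count (λ k → coprime? k m) (d * m)       ≡⟨ count-periodic _ m (coprime-+ˡ-⇔ m) d ⟩
  d * count (λ k → coprime? k m) m         ≡⟨ cong (d *_) (φ≡count m) ⟨
  d * φ m                                  ∎
  where
  open ≡-Reasoning
  coprime-d*m⇔ : ∀ k → Coprime k (d * m) ⇔ Coprime k m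
  coprime-d*m⇔ k = mk⇔ (proj₂ ∘ Equivalence.to (coprime-*-⇔ k d m))
    (λ c → Equivalence.from (coprime-*-⇔ k d m) ((λ {_} (e∣k , e∣d) → c (e∣k , ∣-trans e∣d d∣m)) , c))

φ[p*m]+φ[m]≡p*φ[m] : ∀ {p} m → Prime p → ¬ p ∣ m → φ (p * m) + φ m ≡ p * φ m
φ[p*m]+φ[m]≡p*φ[m] {p} m p-prime p∤m = begin
  φ (p * m) + φ m ≡⟨ cong₂ _+_ (φ≡count (p * m)) φ[m]≡coprime-multiples ⟩
  count (λ k → coprime? k (p * m)) (p * m) + count (λ k → C? k ×-dec p ∣? k) (p * m)
    ≡⟨ cong (_+ count (λ k → C? k ×-dec p ∣? k) (p * m)) (count-cong _ _ (p * m) (λ k _ _ → coprime-p*m⇔ k)) ⟩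
  count (λ k → C? k ×-dec ¬? (p ∣? k)) (p * m) + count (λ k → C? k ×-dec p ∣? k) (p * m) ≡⟨ count-split C? (p ∣?_) (p * m) ⟩
  count C? (p * m)                                                   ≡⟨ count-periodic C? m (coprime-+ˡ-⇔ m) p ⟩
  p * count C? m                                                     ≡⟨ cong (p *_) (φ≡count m) ⟨
  p * φ m                                                            ∎
  where
  open ≡-Reasoning
  instance _ = prime⇒nonZero p-prime
  C? = λ k → coprime? k m
  φ[m]≡coprime-multiples : φ m ≡ count (λ k → C? k ×-dec p ∣? k) (p * m)
  φ[m]≡coprime-multiples = begin
    φ m                                     ≡⟨ φ≡count m ⟩
    count C? m                              ≡⟨ count-cong _ _ m (λ j _ _ → coprime-*p⇔ j) ⟩
    count (C? ∘ (_* p)) m                   ≡⟨ count-multiples C? p m ⟨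
    count (λ k → C? k ×-dec p ∣? k) (m * p) ≡⟨ cong (count (λ k → C? k ×-dec p ∣? k)) (*-comm m p) ⟩
    count (λ k → C? k ×-dec p ∣? k) (p * m) ∎
    where
    coprime-*p⇔ : ∀ j → Coprime j m ⇔ Coprime (j * p) m
    coprime-*p⇔ j = mk⇔ to from
      where
      to : Coprime j m → Coprime (j * p) m
      to c = Coprime.sym (Equivalence.from (coprime-*-⇔ m j p)
               (Coprime.sym c , Equivalence.from (coprime-prime-⇔ m p-prime) p∤m))
      from : Coprime (j * p) m → Coprime j m
      from c = Coprime.sym (proj₁ (Equivalence.to (coprime-*-⇔ m j p) (Coprime.sym c)))
  coprime-p*m⇔ : ∀ k → Coprime k (p * m) ⇔ (Coprime k m × ¬ p ∣ k)
  coprime-p*m⇔ k = mk⇔ to from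
    where
    to : Coprime k (p * m) → Coprime k m × ¬ p ∣ k
    to c = proj₂ (Equivalence.to (coprime-*-⇔ k p m) c)
         , Equivalence.to (coprime-prime-⇔ k p-prime) (proj₁ (Equivalence.to (coprime-*-⇔ k p m) c))
    from : Coprime k m × ¬ p ∣ k → Coprime k (p * m)
    from (cm , p∤k) = Equivalence.from (coprime-*-⇔ k p m) (Equivalence.from (coprime-prime-⇔ k p-prime) p∤k , cm)

φ[p*m]≡[p∸1]*φ[m] : ∀ {p} m → Prime p → ¬ p ∣ m → φ (p * m) ≡ (p ∸ 1) * φ m
φ[p*m]≡[p∸1]*φ[m] {p} m p-prime p∤m = begin
  φ (p * m)             ≡⟨ m+n∸n≡m (φ (p * m)) (φ m) ⟨
  φ (p * m) + φ m ∸ φ m ≡⟨ cong (_∸ φ m) (φ[p*m]+φ[m]≡p*φ[m] m p-prime p∤m) ⟩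
  p * φ m ∸ φ m         ≡⟨ cong (p * φ m ∸_) (*-identityˡ (φ m)) ⟨
  p * φ m ∸ 1 * φ m     ≡⟨ *-distribʳ-∸ (φ m) p 1 ⟨
  (p ∸ 1) * φ m         ∎
  where open ≡-Reasoning

φ[q^[1+a]*m] : ∀ {q} a m → Prime q → ¬ q ∣ m → φ (q ^ suc a * m) ≡ q ^ a * ((q ∸ 1) * φ m)
φ[q^[1+a]*m] {q} zero m q-prime q∤m = begin
  φ (q * 1 * m) ≡⟨ cong (λ x → φ (x * m)) (*-identityʳ q) ⟩
  φ (q * m)     ≡⟨ φ[p*m]≡[p∸1]*φ[m] m q-prime q∤m ⟩
  (q ∸ 1) * φ m ≡⟨ *-identityˡ _ ⟨
  1 * ((q ∸ 1) * φ m) ∎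
  where open ≡-Reasoning
φ[q^[1+a]*m] {q} (suc a) m q-prime q∤m = begin
  φ (q * q ^ suc a * m)         ≡⟨ cong φ (*-assoc q (q ^ suc a) m) ⟩
  φ (q * (q ^ suc a * m))       ≡⟨ φ[d*m]≡d*φ[m] {q} (q ^ suc a * m) (∣m⇒∣m*n m (∣m⇒∣m*n (q ^ a) ∣-refl)) ⟩
  q * φ (q ^ suc a * m)         ≡⟨ cong (q *_) (φ[q^[1+a]*m] a m q-prime q∤m) ⟩
  q * (q ^ a * ((q ∸ 1) * φ m)) ≡⟨ *-assoc q (q ^ a) _ ⟨
  q * q ^ a * ((q ∸ 1) * φ m)   ∎
  where open ≡-Reasoning

φ[q^[1+b]]≡q^b*[q∸1] : ∀ {q} b → Prime q → φ (q ^ suc b) ≡ q ^ b * (q ∸ 1)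
φ[q^[1+b]]≡q^b*[q∸1] {q} b q-prime = begin
  φ (q ^ suc b)         ≡⟨ cong φ (*-identityʳ (q ^ suc b)) ⟨
  φ (q ^ suc b * 1)     ≡⟨ φ[q^[1+a]*m] b 1 q-prime (prime∤1 q-prime) ⟩
  q ^ b * ((q ∸ 1) * 1) ≡⟨ cong (q ^ b *_) (*-identityʳ (q ∸ 1)) ⟩
  q ^ b * (q ∸ 1)       ∎
  where open ≡-Reasoning

φ[p]≡p∸1 : ∀ {p} → Prime p → φ p ≡ p ∸ 1
φ[p]≡p∸1 {p} p-prime = begin
  φ p         ≡⟨ cong φ (*-identityʳ p) ⟨
  φ (p * 1)   ≡⟨ φ[p*m]≡[p∸1]*φ[m] 1 p-prime (prime∤1 p-prime) ⟩
  (p ∸ 1) * 1 ≡⟨ *-identityʳ (p ∸ 1) ⟩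
  p ∸ 1       ∎
  where open ≡-Reasoning

φ[2*m]≡φ[m] : ∀ m → ¬ 2 ∣ m → φ (2 * m) ≡ φ m
φ[2*m]≡φ[m] m 2∤m = trans (φ[p*m]≡[p∸1]*φ[m] m prime[2] 2∤m) (*-identityˡ (φ m))

φ[2^[1+a]*m]≡2^a*φ[m] : ∀ a m → ¬ 2 ∣ m → φ (2 ^ suc a * m) ≡ 2 ^ a * φ m
φ[2^[1+a]*m]≡2^a*φ[m] a m 2∤m =
  trans (φ[q^[1+a]*m] a m prime[2] 2∤m) (cong (2 ^ a *_) (*-identityˡ (φ m)))

φ[m]∣φ[2^a*m] : ∀ a m → ¬ 2 ∣ m → φ m ∣ φ (2 ^ a * m)
φ[m]∣φ[2^a*m] zero    m 2∤m = ∣-reflexive (cong φ (sym (*-identityˡ m)))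
φ[m]∣φ[2^a*m] (suc a) m 2∤m = divides (2 ^ a) (φ[2^[1+a]*m]≡2^a*φ[m] a m 2∤m)

2^a*φ[m]≤2*φ[2^a*m] : ∀ a m → ¬ 2 ∣ m → 2 ^ a * φ m ≤ 2 * φ (2 ^ a * m)
2^a*φ[m]≤2*φ[2^a*m] zero    m 2∤m = subst₂ _≤_ (sym (*-identityˡ (φ m))) (cong (λ k → 2 * φ k) (sym (*-identityˡ m))) (m≤n*m (φ m) 2)
2^a*φ[m]≤2*φ[2^a*m] (suc a) m 2∤m = begin
  2 * 2 ^ a * φ m   ≡⟨ *-assoc 2 (2 ^ a) (φ m) ⟩
  2 * (2 ^ a * φ m) ≡⟨ cong (2 *_) (φ[2^[1+a]*m]≡2^a*φ[m] a m 2∤m) ⟨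
  2 * φ (2 ^ suc a * m) ∎
  where open ≤-Reasoning

4∣φ[2^[3+a]] : ∀ a → 2 * 2 ∣ φ (2 ^ (3 + a) * 1)
4∣φ[2^[3+a]] a = divides (2 ^ a) (trans (φ[2^[1+a]*m]≡2^a*φ[m] (2 + a) 1 (prime∤1 prime[2])) (regroup (2 ^ a)))
  where
  regroup : ∀ x → 2 * (2 * x) * 1 ≡ x * (2 * 2)
  regroup = solve 1 (λ x → con 2 :* (con 2 :* x) :* con 1 := x :* (con 2 :* con 2)) refl

-- Factorisation

factor-out : ∀ p → 2 ≤ p → ∀ m → 1 ≤ m → ∃₂ λ a m′ → m ≡ p ^ a * m′ × ¬ p ∣ m′ × 1 ≤ m′
factor-out p 2≤p = <-rec _ go
  where
  go : ∀ m → (∀ {k} → k < m → 1 ≤ k → ∃₂ λ a m′ → k ≡ p ^ a * m′ × ¬ p ∣ m′ × 1 ≤ m′) →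
       1 ≤ m → ∃₂ λ a m′ → m ≡ p ^ a * m′ × ¬ p ∣ m′ × 1 ≤ m′
  go m rec 1≤m with p ∣? m
  ... | no p∤m = 0 , m , sym (+-identityʳ m) , p∤m , 1≤m
  ... | yes (divides zero refl) = ⊥-elim (<⇒≱ 1≤m z≤n)
  ... | yes (divides k@(suc _) refl) with rec (m<m*n k p 2≤p) (s≤s z≤n)
  ...   | a , m′ , k≡p^a*m′ , p∤m′ , 1≤m′ = suc a , m′ , k*p≡p^[1+a]*m′ , p∤m′ , 1≤m′
    where
    open ≡-Reasoning
    k*p≡p^[1+a]*m′ : k * p ≡ p ^ suc a * m′
    k*p≡p^[1+a]*m′ = begin
      k * p            ≡⟨ cong (_* p) k≡p^a*m′ ⟩
      p ^ a * m′ * p   ≡⟨ *-comm (p ^ a * m′) p ⟩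
      p * (p ^ a * m′) ≡⟨ *-assoc p (p ^ a) m′ ⟨
      p ^ suc a * m′   ∎

v₂-exists : ∀ n → 1 ≤ n → ∃ (IsV2 n)
v₂-exists n 1≤n with factor-out 2 ≤-refl n 1≤n
... | a , n′ , refl , 2∤n′ , _ =
  a , divides n′ (*-comm (2 ^ a) n′) ,
  λ 2^[1+a]∣n → 2∤n′ (*-cancelˡ-∣ (2 ^ a) {{m^n≢0 2 a}} (subst (_∣ 2 ^ a * n′) (*-comm 2 (2 ^ a)) 2^[1+a]∣n))

least-prime-factor : ∀ m → 2 ≤ m → ∃ λ q → Prime q × q ∣ m × (∀ r → Prime r → r ∣ m → q ≤ r)
least-prime-factor m 2≤m = search (m ∸ 2) 2 ≤-refl (m+[n∸m]≡n 2≤m) 2-rough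
  where
  search : ∀ j d → 2 ≤ d → d + j ≡ m → d Rough m →
           ∃ λ q → Prime q × q ∣ m × (∀ r → Prime r → r ∣ m → q ≤ r)
  search j d 2≤d d+j≡m rough with d ∣? m
  ... | yes d∣m = d , rough∧∣⇒prime {{n>1⇒nonTrivial 2≤d}} rough d∣m , d∣m , least
    where
    least : ∀ r → Prime r → r ∣ m → d ≤ r
    least r r-prime r∣m with r <? d
    ... | yes r<d = ⊥-elim (rough (hasNonTrivialDivisor {{prime⇒nonTrivial r-prime}} r<d r∣m))
    ... | no r≮d  = ≮⇒≥ r≮d
  search zero    d 2≤d d+0≡m rough | no d∤m =
    ⊥-elim (d∤m (subst (d ∣_) (trans (sym (+-identityʳ d)) d+0≡m) ∣-refl))
  search (suc j) d 2≤d d+j≡m rough | no d∤m =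
    search j (suc d) (m≤n⇒m≤1+n 2≤d) (trans (sym (+-suc d j)) d+j≡m) (∤⇒rough-suc d∤m rough)

record LeastPrimeSplit (m : ℕ) : Set where
  constructor least-split
  field
    q a m′       : ℕ
    q-prime      : Prime q
    m≡q^[1+a]*m′ : m ≡ q ^ suc a * m′
    q∤m′         : ¬ q ∣ m′
    1≤m′         : 1 ≤ m′
    q<factors    : ∀ r → Prime r → r ∣ m′ → q < r

least-prime-split : ∀ m → 2 ≤ m → LeastPrimeSplit m
least-prime-split m 2≤m with least-prime-factor m 2≤m
... | q , q-prime , q∣m , q-least with factor-out q (prime⇒2≤ q-prime) m (≤-trans (s≤s z≤n) 2≤m)
...   | zero , m′ , m≡1*m′ , q∤m′ , 1≤m′ = ⊥-elim (q∤m′ (subst (q ∣_) (trans m≡1*m′ (*-identityˡ m′)) q∣m))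
...   | suc a , m′ , m≡q^[1+a]*m′ , q∤m′ , 1≤m′ = least-split q a m′ q-prime m≡q^[1+a]*m′ q∤m′ 1≤m′ q<factors
  where
  q<factors : ∀ r → Prime r → r ∣ m′ → q < r
  q<factors r r-prime r∣m′ with m≤n⇒m<n∨m≡n (q-least r r-prime (subst (r ∣_) (sym m≡q^[1+a]*m′) (∣n⇒∣m*n (q ^ suc a) r∣m′)))
  ... | inj₁ q<r  = q<r
  ... | inj₂ refl = ⊥-elim (q∤m′ r∣m′)

2*φ[m]∣φ[q^[1+a]*m] : ∀ {q} a m → Prime q → 2 < q → ¬ q ∣ m → 2 * φ m ∣ φ (q ^ suc a * m)
2*φ[m]∣φ[q^[1+a]*m] {q} a m q-prime 2<q q∤m =
  subst (2 * φ m ∣_) (sym (φ[q^[1+a]*m] a m q-prime q∤m))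
    (∣n⇒∣m*n (q ^ a) (*-monoˡ-∣ (φ m) (2∣odd-prime∸1 q-prime 2<q)))

2∣φ[odd] : ∀ m → 2 ≤ m → ¬ 2 ∣ m → 2 ∣ φ m
2∣φ[odd] m 2≤m 2∤m with least-prime-split m 2≤m
... | least-split q a m′ q-prime refl q∤m′ _ _ =
  ∣-trans (∣m⇒∣m*n (φ m′) ∣-refl)
    (2*φ[m]∣φ[q^[1+a]*m] a m′ q-prime (prime∣odd⇒2<p q-prime (∣m⇒∣m*n m′ (∣m⇒∣m*n (q ^ a) ∣-refl)) 2∤m) q∤m′)

4∣φ[2^[2+a]*m] : ∀ a m → 2 ≤ m → ¬ 2 ∣ m → 2 * 2 ∣ φ (2 ^ (2 + a) * m)
4∣φ[2^[2+a]*m] a m 2≤m 2∤m =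
  subst (2 * 2 ∣_) (sym (trans (φ[2^[1+a]*m]≡2^a*φ[m] (suc a) m 2∤m) (*-assoc 2 (2 ^ a) (φ m))))
    (*-monoʳ-∣ 2 (∣n⇒∣m*n (2 ^ a) (2∣φ[odd] m 2≤m 2∤m)))

odd-4∤φ⇒prime-power : ∀ m → 2 ≤ m → ¬ 2 ∣ m → ¬ 2 * 2 ∣ φ m → ∃₂ λ q b → Prime q × 2 < q × m ≡ q ^ suc b
odd-4∤φ⇒prime-power m 2≤m 2∤m 4∤φm with least-prime-split m 2≤m
... | least-split q b m′ q-prime refl q∤m′ 1≤m′ _ with m≤n⇒m<n∨m≡n 1≤m′
...   | inj₂ refl  = q , b , q-prime , 2<q , *-identityʳ (q ^ suc b)
  where 2<q = prime∣odd⇒2<p q-prime (∣m⇒∣m*n 1 (∣m⇒∣m*n (q ^ b) ∣-refl)) 2∤m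
...   | inj₁ 2≤m′ = ⊥-elim (4∤φm (∣-trans (*-monoʳ-∣ 2 (2∣φ[odd] m′ 2≤m′ 2∤m′))
                              (2*φ[m]∣φ[q^[1+a]*m] b m′ q-prime 2<q q∤m′)))
  where
  2<q = prime∣odd⇒2<p q-prime (∣m⇒∣m*n m′ (∣m⇒∣m*n (q ^ b) ∣-refl)) 2∤m
  2∤m′ = 2∤m ∘ ∣n⇒∣m*n (q ^ suc b)

-- The ratio m / φ m

-- f i ≤ rᵢ for every increasing sequence of primes lo < r₀ < r₁ < ⋯
BoundedByPrimesAbove : (s : ℕ) → (Fin s → ℕ) → ℕ → Set
BoundedByPrimesAbove zero    f lo = ⊤
BoundedByPrimesAbove (suc s) f lo =
  (∀ q → Prime q → lo < q → f zero ≤ q) × BoundedByPrimesAbove s (f ∘ suc) (f zero)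

bounded-by-steps : ∀ s (f : Fin (suc s) → ℕ) lo → (∀ q → Prime q → lo < q → f zero ≤ q) →
  (∀ (i : Fin s) q → Prime q → f (inject₁ i) < q → f (suc i) ≤ q) → BoundedByPrimesAbove (suc s) f lo
bounded-by-steps zero    f lo first step = first , tt
bounded-by-steps (suc s) f lo first step =
  first , bounded-by-steps s (f ∘ suc) (f zero) (step zero) (step ∘ suc)

prodF-mono-≤ : ∀ s {f g : Fin s → ℕ} → (∀ i → f i ≤ g i) → prodF s f ≤ prodF s g
prodF-mono-≤ zero    f≤g = ≤-refl
prodF-mono-≤ (suc s) f≤g = *-mono-≤ (f≤g zero) (prodF-mono-≤ s (f≤g ∘ suc))

m*[n∸1]≤[m∸1]*n : ∀ m n → n ≤ m → m * (n ∸ 1) ≤ (m ∸ 1) * n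
m*[n∸1]≤[m∸1]*n m n n≤m = begin
  m * (n ∸ 1)   ≡⟨ *-distribˡ-∸ m n 1 ⟩
  m * n ∸ m * 1 ≤⟨ ∸-monoʳ-≤ (m * n) (subst₂ _≤_ (sym (*-identityˡ n)) (sym (*-identityʳ m)) n≤m) ⟩
  m * n ∸ 1 * n ≡⟨ *-distribʳ-∸ n m 1 ⟨
  (m ∸ 1) * n   ∎
  where open ≤-Reasoning

prime-power-ratio-step : ∀ q Q m′ f A Φ′ B → f ≤ q → m′ * A ≤ Φ′ * B →
  q * Q * m′ * ((f ∸ 1) * A) ≤ Q * ((q ∸ 1) * Φ′) * (f * B)
prime-power-ratio-step q Q m′ f A Φ′ B f≤q m′A≤Φ′B = begin
  q * Q * m′ * ((f ∸ 1) * A)   ≡⟨ regroupˡ q Q m′ (f ∸ 1) A ⟩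
  Q * (q * (f ∸ 1)) * (m′ * A) ≤⟨ *-mono-≤ (*-monoʳ-≤ Q (m*[n∸1]≤[m∸1]*n q f f≤q)) m′A≤Φ′B ⟩
  Q * ((q ∸ 1) * f) * (Φ′ * B) ≡⟨ regroupʳ Q (q ∸ 1) f Φ′ B ⟩
  Q * ((q ∸ 1) * Φ′) * (f * B) ∎
  where
  open ≤-Reasoning
  regroupˡ : ∀ q Q m′ x A → q * Q * m′ * (x * A) ≡ Q * (q * x) * (m′ * A)
  regroupˡ = solve 5 (λ q Q m′ x A → q :* Q :* m′ :* (x :* A) := Q :* (q :* x) :* (m′ :* A)) refl
  regroupʳ : ∀ Q y f Φ′ B → Q * (y * f) * (Φ′ * B) ≡ Q * (y * Φ′) * (f * B)
  regroupʳ = solve 5 (λ Q y f Φ′ B → Q :* (y :* f) :* (Φ′ :* B) := Q :* (y :* Φ′) :* (f :* B)) refl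

odd-ratio-bound : ∀ s (f : Fin s → ℕ) lo m → BoundedByPrimesAbove s f lo →
  1 ≤ m → ¬ 2 ∣ m → (∀ r → Prime r → r ∣ m → lo < r) → ¬ 2 ^ suc s ∣ φ m →
  m * prodF s (λ i → f i ∸ 1) ≤ φ m * prodF s f
odd-ratio-bound s f lo m bounded 1≤m 2∤m lo<factors 2^[1+s]∤φm with m≤n⇒m<n∨m≡n 1≤m
odd-ratio-bound s f lo m bounded 1≤m 2∤m lo<factors 2^[1+s]∤φm | inj₂ refl =
  *-monoʳ-≤ 1 (prodF-mono-≤ s (λ i → m∸n≤m (f i) 1))
odd-ratio-bound zero f lo m bounded 1≤m 2∤m lo<factors 2∤φm | inj₁ 2≤m =
  ⊥-elim (2∤φm (subst (_∣ φ m) (sym (*-identityʳ 2)) (2∣φ[odd] m 2≤m 2∤m)))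
odd-ratio-bound (suc s) f lo m (f₀≤primes , bounded) 1≤m 2∤m lo<factors 2^[2+s]∤φm | inj₁ 2≤m
  with least-prime-split m 2≤m
... | least-split q a m′ q-prime refl q∤m′ 1≤m′ q<factors = begin
  q ^ suc a * m′ * ((f zero ∸ 1) * prodF s (λ i → f (suc i) ∸ 1))
    ≤⟨ prime-power-ratio-step q (q ^ a) m′ (f zero) _ (φ m′) _ f₀≤q ih ⟩
  q ^ a * ((q ∸ 1) * φ m′) * prodF (suc s) f
    ≡⟨ cong (_* prodF (suc s) f) (φ[q^[1+a]*m] a m′ q-prime q∤m′) ⟨
  φ (q ^ suc a * m′) * prodF (suc s) f
    ∎
  where
  open ≤-Reasoning
  q∣m : q ∣ q ^ suc a * m′
  q∣m = ∣m⇒∣m*n m′ (∣m⇒∣m*n (q ^ a) ∣-refl)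
  f₀≤q : f zero ≤ q
  f₀≤q = f₀≤primes q q-prime (lo<factors q q-prime q∣m)
  ih : m′ * prodF s (λ i → f (suc i) ∸ 1) ≤ φ m′ * prodF s (f ∘ suc)
  ih = odd-ratio-bound s (f ∘ suc) (f zero) m′ bounded 1≤m′ (2∤m ∘ ∣n⇒∣m*n (q ^ suc a))
    (λ r r-prime r∣m′ → ≤-<-trans f₀≤q (q<factors r r-prime r∣m′))
    (λ 2^[1+s]∣φm′ → 2^[2+s]∤φm (∣-trans (*-monoʳ-∣ 2 2^[1+s]∣φm′)
      (2*φ[m]∣φ[q^[1+a]*m] a m′ q-prime (prime∣odd⇒2<p q-prime q∣m 2∤m) q∤m′)))

ratio-bound : ∀ s (f : Fin s → ℕ) → BoundedByPrimesAbove s f 2 → ∀ m → 1 ≤ m → ¬ 2 ^ suc s ∣ φ m →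
  m * prodF s (λ i → f i ∸ 1) ≤ 2 * φ m * prodF s f
ratio-bound s f bounded m 1≤m 2^[1+s]∤φm with factor-out 2 ≤-refl m 1≤m
... | a , m′ , refl , 2∤m′ , 1≤m′ = begin
  2 ^ a * m′ * ∏[f∸1]   ≡⟨ *-assoc (2 ^ a) m′ ∏[f∸1] ⟩
  2 ^ a * (m′ * ∏[f∸1]) ≤⟨ *-monoʳ-≤ (2 ^ a) odd-part-bound ⟩
  2 ^ a * (φ m′ * ∏f)   ≡⟨ *-assoc (2 ^ a) (φ m′) ∏f ⟨
  2 ^ a * φ m′ * ∏f     ≤⟨ *-monoˡ-≤ ∏f (2^a*φ[m]≤2*φ[2^a*m] a m′ 2∤m′) ⟩
  2 * φ (2 ^ a * m′) * ∏f ∎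
  where
  open ≤-Reasoning
  ∏[f∸1] = prodF s (λ i → f i ∸ 1)
  ∏f = prodF s f
  odd-part-bound : m′ * ∏[f∸1] ≤ φ m′ * ∏f
  odd-part-bound = odd-ratio-bound s f 2 m′ bounded 1≤m′ 2∤m′
    (λ r r-prime r∣m′ → prime∣odd⇒2<p r-prime r∣m′ 2∤m′)
    (λ 2^[1+s]∣φm′ → 2^[1+s]∤φm (∣-trans 2^[1+s]∣φm′ (φ[m]∣φ[2^a*m] a m′ 2∤m′)))

module _ {t} {ps : Fin (suc t) → ℕ} (first-primes : FirstPrimes (suc t) ps) where

  private
    ps-prime = proj₁ first-primes
    ps-increasing = proj₁ (proj₂ first-primes)
    ps-below-others = proj₂ (proj₂ first-primes)

  first-primes-mono-≤ : ∀ i j → toℕ i ≤ toℕ j → ps i ≤ ps j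
  first-primes-mono-≤ i j i≤j with m≤n⇒m<n∨m≡n i≤j
  ... | inj₁ i<j = <⇒≤ (ps-increasing i j i<j)
  ... | inj₂ i≡j = ≤-reflexive (cong ps (toℕ-injective i≡j))

  first-primes-head : ps zero ≡ 2
  first-primes-head with any? (λ l → ps l ≟ 2)
  ... | no 2∉ps = ⊥-elim (<⇒≱ (ps-below-others 2 prime[2] (λ l e → 2∉ps (l , e)) zero) (prime⇒2≤ (ps-prime zero)))
  ... | yes (l , ps[l]≡2) =
    ≤-antisym (subst (ps zero ≤_) ps[l]≡2 (first-primes-mono-≤ zero l z≤n)) (prime⇒2≤ (ps-prime zero))

  first-primes-step : ∀ (i : Fin t) q → Prime q → ps (inject₁ i) < q → ps (suc i) ≤ q
  first-primes-step i q q-prime ps[i]<q with any? (λ l → ps l ≟ q)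
  ... | no q∉ps = <⇒≤ (ps-below-others q q-prime (λ l e → q∉ps (l , e)) (suc i))
  ... | yes (l , ps[l]≡q) with suc (toℕ i) ≤? toℕ l
  ...   | yes 1+i≤l = subst (ps (suc i) ≤_) ps[l]≡q (first-primes-mono-≤ (suc i) l 1+i≤l)
  ...   | no 1+i≰l = ⊥-elim (<⇒≱ ps[i]<q (subst (_≤ ps (inject₁ i)) ps[l]≡q
                       (first-primes-mono-≤ l (inject₁ i) (subst (toℕ l ≤_) (sym (toℕ-inject₁ i)) (≤-pred (≰⇒> 1+i≰l))))))

  first-primes-bounded : BoundedByPrimesAbove (suc t) ps 1
  first-primes-bounded = bounded-by-steps t ps 1
    (λ q q-prime _ → subst (_≤ q) (sym first-primes-head) (prime⇒2≤ q-prime)) first-primes-step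

  first-primes-ratio-bound : ∀ m → 1 ≤ m → ¬ 2 ^ suc t ∣ φ m →
    m * prodF (suc t) (λ i → ps i ∸ 1) ≤ φ m * prodF (suc t) ps
  first-primes-ratio-bound m 1≤m 2^[1+t]∤φm = begin
    m * ((ps zero ∸ 1) * A) ≡⟨ cong (λ p → m * ((p ∸ 1) * A)) first-primes-head ⟩
    m * (1 * A)             ≡⟨ cong (m *_) (*-identityˡ A) ⟩
    m * A                   ≤⟨ ratio-bound t (ps ∘ suc) bounded m 1≤m 2^[1+t]∤φm ⟩
    2 * φ m * B             ≡⟨ cong (_* B) (*-comm 2 (φ m)) ⟩
    φ m * 2 * B             ≡⟨ *-assoc (φ m) 2 B ⟩
    φ m * (2 * B)           ≡⟨ cong (λ p → φ m * (p * B)) first-primes-head ⟨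
    φ m * (ps zero * B)     ∎
    where
    open ≤-Reasoning
    A = prodF t (λ i → ps (suc i) ∸ 1)
    B = prodF t (ps ∘ suc)
    bounded : BoundedByPrimesAbove t (ps ∘ suc) 2
    bounded = subst (BoundedByPrimesAbove t (ps ∘ suc)) first-primes-head (proj₂ first-primes-bounded)

odds : (s : ℕ) → ℕ → Fin s → ℕ
odds (suc s) c zero    = c
odds (suc s) c (suc i) = odds s (c + 2) i

odds-bounded : ∀ s c lo → 3 ≤ c → ¬ 2 ∣ c → (∀ q → Prime q → lo < q → c ≤ q) →
               BoundedByPrimesAbove s (odds s c) lo
odds-bounded zero    c lo 3≤c 2∤c c≤primes = tt
odds-bounded (suc s) c lo 3≤c 2∤c c≤primes =
  c≤primes , odds-bounded s (c + 2) c (≤-trans 3≤c (m≤m+n c 2)) 2∤c+2 c+2≤primes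
  where
  2∤c+2 : ¬ 2 ∣ c + 2
  2∤c+2 2∣c+2 = 2∤c (∣m+n∣m⇒∣n (subst (2 ∣_) (+-comm c 2) 2∣c+2) ∣-refl)
  c+2≤primes : ∀ q → Prime q → c < q → c + 2 ≤ q
  c+2≤primes q q-prime c<q with m≤n⇒m<n∨m≡n c<q
  ... | inj₁ c+1<q = subst (_≤ q) (+-comm 2 c) c+1<q
  ... | inj₂ refl with 2∣n⊎2∣1+n c
  ...   | inj₁ 2∣c   = ⊥-elim (2∤c 2∣c)
  ...   | inj₂ 2∣1+c with prime⇒irreducible q-prime 2∣1+c
  ...     | inj₁ ()
  ...     | inj₂ 2≡1+c = ⊥-elim (<⇒≢ (s≤s (≤-trans (n≤1+n 2) 3≤c)) 2≡1+c)

∏odds : ℕ → ℕ → ℕ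
∏odds s c = prodF s (odds s c)

∏[odds∸1] : ℕ → ℕ → ℕ
∏[odds∸1] s c = prodF s (λ i → odds s c i ∸ 1)

∏[odds∸1]≥1 : ∀ s c → 2 ≤ c → 1 ≤ ∏[odds∸1] s c
∏[odds∸1]≥1 zero    c       2≤c       = ≤-refl
∏[odds∸1]≥1 (suc s) (suc c) (s≤s 1≤c) = *-mono-≤ 1≤c (∏[odds∸1]≥1 s (suc c + 2) (≤-trans (s≤s 1≤c) (m≤m+n (suc c) 2)))

c³<2*[c∸1]³ : ∀ c → 5 ≤ c → c ^ 3 < 2 * (c ∸ 1) ^ 3
c³<2*[c∸1]³ c@(suc (suc (suc (suc (suc y))))) (s≤s (s≤s (s≤s (s≤s (s≤s _))))) =
  subst (c ^ 3 <_) (sym (difference y)) (m<m+n (c ^ 3) (s≤s z≤n))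
  where
  difference : ∀ y → 2 * (4 + y) ^ 3 ≡ (5 + y) ^ 3 + (3 + (y ^ 3 + 9 * y ^ 2 + 21 * y))
  difference = solve 1 (λ y → con 2 :* (con 4 :+ y) :^ 3
                            := (con 5 :+ y) :^ 3 :+ (con 3 :+ (y :^ 3 :+ con 9 :* y :^ 2 :+ con 21 :* y))) refl

[m*n]³≡m³*n³ : ∀ m n → (m * n) ^ 3 ≡ m ^ 3 * n ^ 3
[m*n]³≡m³*n³ = solve 2 (λ m n → (m :* n) :^ 3 := m :^ 3 :* n :^ 3) refl

mutual
  ∏odds³≤2^s*∏[odds∸1]³ : ∀ s c → 5 ≤ c → ∏odds s c ^ 3 ≤ 2 ^ s * ∏[odds∸1] s c ^ 3
  ∏odds³≤2^s*∏[odds∸1]³ zero    c 5≤c = ≤-refl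
  ∏odds³≤2^s*∏[odds∸1]³ (suc s) c 5≤c = <⇒≤ (∏odds³<2^s*∏[odds∸1]³ s c 5≤c)

  ∏odds³<2^s*∏[odds∸1]³ : ∀ s c → 5 ≤ c → ∏odds (suc s) c ^ 3 < 2 ^ suc s * ∏[odds∸1] (suc s) c ^ 3
  ∏odds³<2^s*∏[odds∸1]³ s c 5≤c = begin-strict
    (c * Num) ^ 3                       ≡⟨ [m*n]³≡m³*n³ c Num ⟩
    c ^ 3 * Num ^ 3                     ≤⟨ *-monoʳ-≤ (c ^ 3) (∏odds³≤2^s*∏[odds∸1]³ s (c + 2) 5≤c+2) ⟩
    c ^ 3 * (2 ^ s * Den ^ 3)           <⟨ *-monoˡ-< (2 ^ s * Den ^ 3) {{2^s*Den³≢0}} (c³<2*[c∸1]³ c 5≤c) ⟩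
    2 * (c ∸ 1) ^ 3 * (2 ^ s * Den ^ 3) ≡⟨ regroup (c ∸ 1) (2 ^ s) Den ⟩
    2 * 2 ^ s * ((c ∸ 1) * Den) ^ 3     ∎
    where
    open ≤-Reasoning
    Num = ∏odds s (c + 2)
    Den = ∏[odds∸1] s (c + 2)
    5≤c+2 = ≤-trans 5≤c (m≤m+n c 2)
    2^s*Den³≢0 : NonZero (2 ^ s * Den ^ 3)
    2^s*Den³≢0 = >-nonZero (*-mono-≤ (m^n>0 2 s) (^-monoˡ-≤ 3 (∏[odds∸1]≥1 s (c + 2) (≤-trans (s≤s (s≤s z≤n)) 5≤c+2))))
    regroup : ∀ x y d → 2 * x ^ 3 * (y * d ^ 3) ≡ 2 * y * (x * d) ^ 3
    regroup = solve 3 (λ x y d → con 2 :* x :^ 3 :* (y :* d :^ 3) := con 2 :* y :* (x :* d) :^ 3) refl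

∏odds³<n*∏[odds∸1]³ : ∀ k n → 1 < n → 2 ^ k ≤ n → ∏odds k 5 ^ 3 < n * ∏[odds∸1] k 5 ^ 3
∏odds³<n*∏[odds∸1]³ zero    n 1<n _ = subst (1 <_) (sym (*-identityʳ n)) 1<n
∏odds³<n*∏[odds∸1]³ (suc k) n 1<n 2^[1+k]≤n =
  <-≤-trans (∏odds³<2^s*∏[odds∸1]³ k 5 ≤-refl) (*-monoˡ-≤ (∏[odds∸1] (suc k) 5 ^ 3) 2^[1+k]≤n)

m³<216n⁴ : ∀ k n m → 1 < n → 2 ^ k ≤ n → m * ∏[odds∸1] k 5 ≤ 6 * n * ∏odds k 5 → m ^ 3 < 216 * n ^ 4
m³<216n⁴ k n m 1<n 2^k≤n m*Den≤6n*Num = *-cancelʳ-< (Den ^ 3) (m ^ 3) (216 * n ^ 4) (begin-strict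
  m ^ 3 * Den ^ 3             ≡⟨ [m*n]³≡m³*n³ m Den ⟨
  (m * Den) ^ 3               ≤⟨ ^-monoˡ-≤ 3 m*Den≤6n*Num ⟩
  (6 * n * Num) ^ 3           ≡⟨ expand n Num ⟩
  216 * n ^ 3 * Num ^ 3       <⟨ *-monoʳ-< (216 * n ^ 3) {{216n³≢0}} (∏odds³<n*∏[odds∸1]³ k n 1<n 2^k≤n) ⟩
  216 * n ^ 3 * (n * Den ^ 3) ≡⟨ collect n Den ⟩
  216 * n ^ 4 * Den ^ 3       ∎)
  where
  open ≤-Reasoning
  Num = ∏odds k 5
  Den = ∏[odds∸1] k 5
  216n³≢0 : NonZero (216 * n ^ 3)
  216n³≢0 = >-nonZero (*-mono-≤ {1} {216} (s≤s z≤n) (^-monoˡ-≤ 3 (<⇒≤ 1<n)))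
  expand : ∀ n p → (6 * n * p) ^ 3 ≡ 216 * n ^ 3 * p ^ 3
  expand = solve 2 (λ n p → (con 6 :* n :* p) :^ 3 := con 216 :* n :^ 3 :* p :^ 3) refl
  collect : ∀ n d → 216 * n ^ 3 * (n * d ^ 3) ≡ 216 * n ^ 4 * d ^ 3
  collect = solve 2 (λ n d → con 216 :* n :^ 3 :* (n :* d :^ 3) := con 216 :* n :^ 4 :* d :^ 3) refl

-- Solutions of φ m ∣ 2 n

φ∣2n⇒φ≤2n : ∀ n m → 1 ≤ n → φ m ∣ 2 * n → φ m ≤ 2 * n
φ∣2n⇒φ≤2n n m 1≤n φm∣2n = ∣⇒≤ {{>-nonZero (≤-trans 1≤n (m≤n*m n 2))}} φm∣2n

φ∣2n⇒2^[1+s]∤φ : ∀ {s} n m → φ m ∣ 2 * n → ¬ 2 ^ s ∣ n → ¬ 2 ^ suc s ∣ φ m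
φ∣2n⇒2^[1+s]∤φ n m φm∣2n 2^s∤n 2^[1+s]∣φm = 2^s∤n (*-cancelˡ-∣ 2 (∣-trans 2^[1+s]∣φm φm∣2n))

φ∣2n⇒m*∏[odds∸1]≤6n*∏odds : ∀ {n m} k → 1 ≤ n → ¬ 2 ^ suc k ∣ n → 1 ≤ m → φ m ∣ 2 * n →
  m * ∏[odds∸1] k 5 ≤ 6 * n * ∏odds k 5
φ∣2n⇒m*∏[odds∸1]≤6n*∏odds {n} {m} k 1≤n 2^[1+k]∤n 1≤m φm∣2n = *-cancelˡ-≤ 2 (begin
  2 * (m * Den)           ≡⟨ x∙yz≈y∙xz 2 m Den ⟩
  m * (2 * Den)           ≤⟨ ratio-bound (suc k) (odds (suc k) 3) odds-from-3-bounded m 1≤m (φ∣2n⇒2^[1+s]∤φ {suc k} n m φm∣2n 2^[1+k]∤n) ⟩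
  2 * φ m * (3 * Num)     ≤⟨ *-monoˡ-≤ (3 * Num) (*-monoʳ-≤ 2 (φ∣2n⇒φ≤2n n m 1≤n φm∣2n)) ⟩
  2 * (2 * n) * (3 * Num) ≡⟨ regroup n Num ⟩
  2 * (6 * n * Num)      ∎)
  where
  open ≤-Reasoning
  Den = ∏[odds∸1] k 5
  Num = ∏odds k 5
  2∤3 : ¬ 2 ∣ 3
  2∤3 (divides (suc zero) ())
  odds-from-3-bounded : BoundedByPrimesAbove (suc k) (odds (suc k) 3) 2
  odds-from-3-bounded = odds-bounded (suc k) 3 2 ≤-refl 2∤3 (λ q _ 2<q → 2<q)
  regroup : ∀ n p → 2 * (2 * n) * (3 * p) ≡ 2 * (6 * n * p)
  regroup = solve 2 (λ n p → con 2 :* (con 2 :* n) :* (con 3 :* p) := con 2 :* (con 6 :* n :* p)) refl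

φ∣2n⇒m≤6n : ∀ {n m} → 1 ≤ n → ¬ 2 ∣ n → 1 ≤ m → φ m ∣ 2 * n → m ≤ 6 * n
φ∣2n⇒m≤6n {n} {m} 1≤n 2∤n 1≤m φm∣2n = subst₂ _≤_ (*-identityʳ m) (*-identityʳ (6 * n))
  (φ∣2n⇒m*∏[odds∸1]≤6n*∏odds 0 1≤n (2∤n ∘ subst (_∣ n) (*-identityʳ 2)) 1≤m φm∣2n)

φ∣2n⇒first-primes-bound : ∀ {n m} k (ps : Fin (2 + k) → ℕ) → 1 ≤ n → ¬ 2 ^ suc k ∣ n → FirstPrimes (2 + k) ps →
  1 ≤ m → φ m ∣ 2 * n → m * prodF (2 + k) (λ i → ps i ∸ 1) ≤ 2 * n * prodF (2 + k) ps
φ∣2n⇒first-primes-bound {n} {m} k ps 1≤n 2^[1+k]∤n first-primes 1≤m φm∣2n =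
  ≤-trans (first-primes-ratio-bound first-primes m 1≤m (φ∣2n⇒2^[1+s]∤φ {suc k} n m φm∣2n 2^[1+k]∤n))
          (*-monoˡ-≤ (prodF (2 + k) ps) (φ∣2n⇒φ≤2n n m 1≤n φm∣2n))

bounded-maximum : ∀ {P : Pred ℕ 0ℓ} → Decidable P → ∀ B → (∀ m → P m → m ≤ B) →
                  ∀ w → P w → ∃ λ M → P M × (∀ m → P m → m ≤ M)
bounded-maximum {P} P? zero    ≤B w Pw with P? zero
... | yes P0 = zero , P0 , ≤B
... | no ¬P0 = ⊥-elim (¬P0 (subst P (n≤0⇒n≡0 (≤B w Pw)) Pw))
bounded-maximum {P} P? (suc B) ≤1+B w Pw with P? (suc B)
... | yes P[1+B] = suc B , P[1+B] , ≤1+B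
... | no ¬P[1+B] = bounded-maximum P? B ≤B w Pw
  where
  ≤B : ∀ m → P m → m ≤ B
  ≤B m Pm with m≤n⇒m<n∨m≡n (≤1+B m Pm)
  ... | inj₁ m<1+B = ≤-pred m<1+B
  ... | inj₂ refl  = ⊥-elim (¬P[1+B] Pm)

φ[6]∣2n : ∀ n → φ 6 ∣ 2 * n
φ[6]∣2n n = divides n (*-comm 2 n)

Φ-exists : ∀ n → 1 ≤ n → ∃ (IsΦ n)
Φ-exists n 1≤n with v₂-exists n 1≤n
... | k , _ , 2^[1+k]∤n = maximum-is-Φ
  (bounded-maximum (λ m → (1 ≤? m) ×-dec (φ m ∣? 2 * n)) (6 * n * ∏odds k 5) bound 6 (s≤s z≤n , φ[6]∣2n n))
  where
  bound : ∀ m → 1 ≤ m × φ m ∣ 2 * n → m ≤ 6 * n * ∏odds k 5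
  bound m (1≤m , φm∣2n) = ≤-trans (m≤m*n m _ {{>-nonZero (∏[odds∸1]≥1 k 5 (s≤s (s≤s z≤n)))}})
    (φ∣2n⇒m*∏[odds∸1]≤6n*∏odds k 1≤n 2^[1+k]∤n 1≤m φm∣2n)
  maximum-is-Φ : (∃ λ M → (1 ≤ M × φ M ∣ 2 * n) × (∀ m → 1 ≤ m × φ m ∣ 2 * n → m ≤ M)) → ∃ (IsΦ n)
  maximum-is-Φ (M , (1≤M , φM∣2n) , maximal) = M , 1≤M , φM∣2n , λ m 1≤m φm∣2n → maximal m (1≤m , φm∣2n)

Φ≥6 : ∀ n {M} → IsΦ n M → 6 ≤ M
Φ≥6 n (_ , _ , maximal) = maximal 6 (s≤s z≤n) (φ[6]∣2n n)

-- n an odd prime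

φ[4n+2]≡2n : ∀ n → Prime (2 * n + 1) → φ (4 * n + 2) ≡ 2 * n
φ[4n+2]≡2n n 2n+1-prime = begin
  φ (4 * n + 2)       ≡⟨ cong φ (double n) ⟩
  φ (2 * (2 * n + 1)) ≡⟨ φ[2*m]≡φ[m] (2 * n + 1) 2∤2n+1 ⟩
  φ (2 * n + 1)       ≡⟨ φ[p]≡p∸1 2n+1-prime ⟩
  2 * n + 1 ∸ 1       ≡⟨ m+n∸n≡m (2 * n) 1 ⟩
  2 * n               ∎
  where
  open ≡-Reasoning
  double : ∀ n → 4 * n + 2 ≡ 2 * (2 * n + 1)
  double = solve 1 (λ n → con 4 :* n :+ con 2 := con 2 :* (con 2 :* n :+ con 1)) refl
  2∤2n+1 : ¬ 2 ∣ 2 * n + 1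
  2∤2n+1 2∣2n+1 = prime∤1 prime[2] (∣m+n∣m⇒∣n 2∣2n+1 (m∣m*n n))

n∸1∣2n⇒n≤3 : ∀ n → n ∸ 1 ∣ 2 * n → n ≤ 3
n∸1∣2n⇒n≤3 zero    _          = z≤n
n∸1∣2n⇒n≤3 (suc k) k∣2[1+k] = s≤s (∣⇒≤ (∣m+n∣m⇒∣n k∣2k+2 (n∣m*n 2)))
  where
  k∣2k+2 : k ∣ 2 * k + 2
  k∣2k+2 = subst (k ∣_) (trans (*-suc 2 k) (+-comm 2 (2 * k))) k∣2[1+k]

module _ {n} (n-prime : Prime n) (3<n : 3 < n) where

  n-odd : ¬ 2 ∣ n
  n-odd 2∣n with prime⇒irreducible n-prime 2∣n
  ... | inj₁ ()
  ... | inj₂ 2≡n = <⇒≢ (<-trans (s≤s (s≤s (s≤s z≤n))) 3<n) 2≡n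

  φ∣2n⇒4∤φ : ∀ m → φ m ∣ 2 * n → ¬ 2 * 2 ∣ φ m
  φ∣2n⇒4∤φ m φm∣2n 4∣φm = n-odd (*-cancelˡ-∣ 2 (∣-trans 4∣φm φm∣2n))

  prime-power-φ∣2n : ∀ {q} b → Prime q → 2 < q → φ (q ^ suc b) ∣ 2 * n →
                     q ^ suc b ≡ 3 ⊎ (q ^ suc b ≡ 2 * n + 1 × Prime (2 * n + 1))
  prime-power-φ∣2n {q} (suc b) q-prime 2<q φ∣2n = ⊥-elim (<⇒≱ 3<n (n∸1∣2n⇒n≤3 n (subst (λ p → p ∸ 1 ∣ 2 * n) q≡n q∸1∣2n)))
    where
    φ∣2n′ : q ^ suc b * (q ∸ 1) ∣ 2 * n
    φ∣2n′ = subst (_∣ 2 * n) (φ[q^[1+b]]≡q^b*[q∸1] (suc b) q-prime) φ∣2n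
    q∸1∣2n : q ∸ 1 ∣ 2 * n
    q∸1∣2n = ∣-trans (n∣m*n (q ^ suc b)) φ∣2n′
    q≡n : q ≡ n
    q≡n with euclidsLemma 2 n q-prime (∣-trans (∣m⇒∣m*n (q ∸ 1) (∣m⇒∣m*n (q ^ b) ∣-refl)) φ∣2n′)
    ... | inj₁ q∣2 = ⊥-elim (<⇒≱ 2<q (∣⇒≤ q∣2))
    ... | inj₂ q∣n with prime⇒irreducible n-prime q∣n
    ...   | inj₁ q≡1 = ⊥-elim (<⇒≱ 2<q (≤-trans (≤-reflexive q≡1) (n≤1+n 1)))
    ...   | inj₂ q≡n = q≡n
  prime-power-φ∣2n {q} zero q-prime 2<q φ∣2n with 2∣odd-prime∸1 q-prime 2<q
  ... | divides c q∸1≡c*2 = [ (λ c≡1 → inj₁ (q^1≡2x+1 c≡1)) , (λ c≡n → inj₂ (q^1≡2x+1 c≡n , subst Prime (q≡2x+1 c≡n) q-prime)) ]′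
                              (prime⇒irreducible n-prime c∣n)
    where
    q∸1≡2c : q ∸ 1 ≡ 2 * c
    q∸1≡2c = trans q∸1≡c*2 (*-comm c 2)
    c∣n : c ∣ n
    c∣n = *-cancelˡ-∣ 2 (subst (_∣ 2 * n) (trans (φ[q^[1+b]]≡q^b*[q∸1] 0 q-prime) (trans (*-identityˡ (q ∸ 1)) q∸1≡2c)) φ∣2n)
    q≡2x+1 : ∀ {x} → c ≡ x → q ≡ 2 * x + 1
    q≡2x+1 refl = trans (sym (m∸n+n≡m (<-trans (s≤s z≤n) 2<q))) (cong (_+ 1) q∸1≡2c)
    q^1≡2x+1 : ∀ {x} → c ≡ x → q ^ 1 ≡ 2 * x + 1
    q^1≡2x+1 c≡x = trans (*-identityʳ q) (q≡2x+1 c≡x)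

  odd-φ∣2n : ∀ m → 2 ≤ m → ¬ 2 ∣ m → φ m ∣ 2 * n → m ≡ 3 ⊎ (m ≡ 2 * n + 1 × Prime (2 * n + 1))
  odd-φ∣2n m 2≤m 2∤m φm∣2n = from-prime-power (odd-4∤φ⇒prime-power m 2≤m 2∤m (φ∣2n⇒4∤φ m φm∣2n))
    where
    from-prime-power : (∃₂ λ q b → Prime q × 2 < q × m ≡ q ^ suc b) → m ≡ 3 ⊎ (m ≡ 2 * n + 1 × Prime (2 * n + 1))
    from-prime-power (q , b , q-prime , 2<q , m≡q^[1+b]) =
      subst (λ x → x ≡ 3 ⊎ (x ≡ 2 * n + 1 × Prime (2 * n + 1))) (sym m≡q^[1+b])
        (prime-power-φ∣2n b q-prime 2<q (subst (λ x → φ x ∣ 2 * n) m≡q^[1+b] φm∣2n))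

  2^a*odd≤6⊎≤4n+2 : ∀ a m → ¬ 2 ∣ m → 1 ≤ m → φ (2 ^ a * m) ∣ 2 * n →
                     2 ^ a * m ≤ 6 ⊎ (Prime (2 * n + 1) × 2 ^ a * m ≤ 4 * n + 2)
  2^a*odd≤6⊎≤4n+2 a                   0 _ () _
  2^a*odd≤6⊎≤4n+2 0                   1 _ _ _ = inj₁ (s≤s z≤n)
  2^a*odd≤6⊎≤4n+2 1                   1 _ _ _ = inj₁ (s≤s (s≤s z≤n))
  2^a*odd≤6⊎≤4n+2 2                   1 _ _ _ = inj₁ (s≤s (s≤s (s≤s (s≤s z≤n))))
  2^a*odd≤6⊎≤4n+2 (suc (suc (suc a))) 1 _ _ φ∣2n = ⊥-elim (φ∣2n⇒4∤φ (2 ^ (3 + a) * 1) φ∣2n (4∣φ[2^[3+a]] a))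
  2^a*odd≤6⊎≤4n+2 a m@(suc (suc _)) 2∤m _ φ∣2n =
    from-odd-part a m (s≤s (s≤s z≤n)) 2∤m (odd-φ∣2n m (s≤s (s≤s z≤n)) 2∤m (∣-trans (φ[m]∣φ[2^a*m] a m 2∤m) φ∣2n)) φ∣2n
    where
    from-odd-part : ∀ a m → 2 ≤ m → ¬ 2 ∣ m → m ≡ 3 ⊎ (m ≡ 2 * n + 1 × Prime (2 * n + 1)) → φ (2 ^ a * m) ∣ 2 * n →
                    2 ^ a * m ≤ 6 ⊎ (Prime (2 * n + 1) × 2 ^ a * m ≤ 4 * n + 2)
    from-odd-part (suc (suc a)) m 2≤m 2∤m _ φ∣2n = ⊥-elim (φ∣2n⇒4∤φ (2 ^ (2 + a) * m) φ∣2n (4∣φ[2^[2+a]*m] a m 2≤m 2∤m))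
    from-odd-part 0 .3 _ _ (inj₁ refl) _ = inj₁ (s≤s (s≤s (s≤s z≤n)))
    from-odd-part 1 .3 _ _ (inj₁ refl) _ = inj₁ ≤-refl
    from-odd-part 0 .(2 * n + 1) _ _ (inj₂ (refl , 2n+1-prime)) _ =
      inj₂ (2n+1-prime , ≤-trans (≤-reflexive (*-identityˡ _)) (+-mono-≤ (*-monoˡ-≤ n {2} {4} (s≤s (s≤s z≤n))) (s≤s z≤n)))
    from-odd-part 1 .(2 * n + 1) _ _ (inj₂ (refl , 2n+1-prime)) _ = inj₂ (2n+1-prime , ≤-reflexive (double n))
      where
      double : ∀ n → 2 * 1 * (2 * n + 1) ≡ 4 * n + 2
      double = solve 1 (λ n → con 2 :* con 1 :* (con 2 :* n :+ con 1) := con 4 :* n :+ con 2) refl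

  φ∣2n⇒m≤6⊎m≤4n+2 : ∀ m → 1 ≤ m → φ m ∣ 2 * n → m ≤ 6 ⊎ (Prime (2 * n + 1) × m ≤ 4 * n + 2)
  φ∣2n⇒m≤6⊎m≤4n+2 m 1≤m = from-2-adic (factor-out 2 ≤-refl m 1≤m)
    where
    from-2-adic : (∃₂ λ a m′ → m ≡ 2 ^ a * m′ × ¬ 2 ∣ m′ × 1 ≤ m′) →
                  φ m ∣ 2 * n → m ≤ 6 ⊎ (Prime (2 * n + 1) × m ≤ 4 * n + 2)
    from-2-adic (a , m′ , m≡2^a*m′ , 2∤m′ , 1≤m′) =
      subst (λ x → φ x ∣ 2 * n → x ≤ 6 ⊎ (Prime (2 * n + 1) × x ≤ 4 * n + 2)) (sym m≡2^a*m′)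
        (2^a*odd≤6⊎≤4n+2 a m′ 2∤m′ 1≤m′)

  Φ-of-prime : ∀ {M} → IsΦ n M → (¬ Prime (2 * n + 1) → M ≡ 6) × (Prime (2 * n + 1) → M ≡ 4 * n + 2)
  Φ-of-prime {M} isΦ@(1≤M , φM∣2n , maximal) = composite-case , prime-case
    where
    composite-case : ¬ Prime (2 * n + 1) → M ≡ 6
    composite-case 2n+1-composite =
      [ (λ M≤6 → ≤-antisym M≤6 (Φ≥6 n isΦ)) , (λ (2n+1-prime , _) → ⊥-elim (2n+1-composite 2n+1-prime)) ]′
        (φ∣2n⇒m≤6⊎m≤4n+2 M 1≤M φM∣2n)
    prime-case : Prime (2 * n + 1) → M ≡ 4 * n + 2
    prime-case 2n+1-prime =
      [ (λ M≤6 → ⊥-elim (<⇒≱ 6<4n+2 (≤-trans 4n+2≤M M≤6))) , (λ (_ , M≤4n+2) → ≤-antisym M≤4n+2 4n+2≤M) ]′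
        (φ∣2n⇒m≤6⊎m≤4n+2 M 1≤M φM∣2n)
      where
      4n+2≤M : 4 * n + 2 ≤ M
      4n+2≤M = maximal (4 * n + 2) (≤-trans (s≤s z≤n) (m≤n+m 2 (4 * n)))
                 (subst (_∣ 2 * n) (sym (φ[4n+2]≡2n n 2n+1-prime)) ∣-refl)
      6<4n+2 : 6 < 4 * n + 2
      6<4n+2 = ≤-trans (m≤m+n 7 11) (+-monoˡ-≤ 2 (*-monoʳ-≤ 4 3<n))

Φ[1]≡6 : IsΦ 1 6
Φ[1]≡6 = s≤s z≤n , φ[6]∣2n 1 , λ m 1≤m φm∣2 → φ∣2n⇒m≤6n ≤-refl (prime∤1 prime[2]) 1≤m φm∣2

Φ³<216n⁴ : ∀ n {M} → 1 < n → IsΦ n M → M ^ 3 < 216 * n ^ 4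
Φ³<216n⁴ n {M} 1<n (1≤M , φM∣2n , _) with v₂-exists n (<⇒≤ 1<n)
... | k , 2^k∣n , 2^[1+k]∤n = m³<216n⁴ k n M 1<n (∣⇒≤ {{>-nonZero (<⇒≤ 1<n)}} 2^k∣n)
  (φ∣2n⇒m*∏[odds∸1]≤6n*∏odds k (<⇒≤ 1<n) 2^[1+k]∤n 1≤M φM∣2n)

Φ-first-primes-bound : ∀ n {M} → 0 < n → IsΦ n M → ∀ k (ps : Fin (k + 2) → ℕ) → IsV2 n k → FirstPrimes (k + 2) ps →
  M * prodF (k + 2) (λ i → ps i ∸ 1) ≤ 2 * n * prodF (k + 2) ps
Φ-first-primes-bound n {M} 0<n (1≤M , φM∣2n , _) k =
  subst (λ t → ∀ (ps : Fin t → ℕ) → IsV2 n k → FirstPrimes t ps → M * prodF t (λ i → ps i ∸ 1) ≤ 2 * n * prodF t ps)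
    (+-comm 2 k)
    (λ ps (_ , 2^[1+k]∤n) first-primes → φ∣2n⇒first-primes-bound k ps 0<n 2^[1+k]∤n first-primes 1≤M φM∣2n)

Φ≤6n : ∀ n {M} → 0 < n → IsΦ n M → ¬ 2 ∣ n → M ≤ 6 * n
Φ≤6n n 0<n (1≤M , φM∣2n , _) 2∤n = φ∣2n⇒m≤6n 0<n 2∤n 1≤M φM∣2n

proposition5p2 :
    -- (1)
    (IsΦ 1 6 ×
     (∀ n → 1 < n → ∃ λ M → IsΦ n M × 6 ≤ M × M ^ 3 < 216 * n ^ 4)) ×
    -- (2)
    (∀ n → 0 < n → ∃ λ M → IsΦ n M ×
      (∀ k (ps : Fin (k + 2) → ℕ) → IsV2 n k → FirstPrimes (k + 2) ps →
        M * prodF (k + 2) (λ i → ps i ∸ 1) ≤ 2 * n * prodF (k + 2) ps) ×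
      (¬ (2 ∣ n) → M ≤ 6 * n)) ×
    -- (3)
    (∀ n → Prime n → 3 < n → ∃ λ M → IsΦ n M ×
      (¬ Prime (2 * n + 1) → M ≡ 6) ×
      (Prime (2 * n + 1) → M ≡ 4 * n + 2))
proposition5p2 =
  (Φ[1]≡6 , λ n 1<n → let M , isΦ = Φ-exists n (<⇒≤ 1<n) in
    M , isΦ , Φ≥6 n isΦ , Φ³<216n⁴ n 1<n isΦ) ,
  (λ n 0<n → let M , isΦ = Φ-exists n 0<n in
    M , isΦ , Φ-first-primes-bound n 0<n isΦ , Φ≤6n n 0<n isΦ) ,
  (λ n n-prime 3<n → let M , isΦ = Φ-exists n (≤-trans (s≤s z≤n) 3<n) in
    M , isΦ , Φ-of-prime n-prime 3<n isΦ)
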